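{- For every shape $\lambda$, $$\sum_{T\in\mathrm{SCT}(\lambda)}\mathrm{sgn}(T)=I_\lambda,$$ where $\mathrm{SCT}(\lambda)$ is the set of chess tableaux on $\lambda$.
   Context: A shape $\lambda$ is the Ferrers diagram of an integer partition, with square $(r,c)$ in row $r$ and column $c$. A standard Young tableau (SYT) on an $n$-shape is a filling with $1,\ldots,n$, each once, increasing along rows and down columns. The sign $\mathrm{sgn}(T)$ of a tableau is the sign of the word obtained by reading its entries row by row, left to right, top to bottom; the sign of a word of distinct integers is $(-1)^{\#\text{inversions}}$. $I_\lambda=\sum_{T\in\mathrm{SYT}(\lambda)}\mathrm{sgn}(T)$. Chess colouring: square $(r,c)$ is black if $r+c$ is even and white if $r+c$ is odd. A chess tableau is a SYT with odd integers in black squares and even integers in white squares. -}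

module Defs where

open import Data.Bool using (Bool; true; false; _∧_; _∨_; not; if_then_else_)
open import Data.Nat using (ℕ; zero; suc; _+_; _≥_; _<ᵇ_; _≤ᵇ_; _≡ᵇ_; NonZero)
open import Data.Nat.Properties using ()
import Data.Nat as N
open import Data.Integer using (ℤ; -1ℤ; 0ℤ; _^_) renaming (_+_ to _+ℤ_)
open import Data.List using (List; []; _∷_; map; concat; concatMap; upTo; length)
open import Data.Nat.ListAction using (sum)
open import Data.List.Relation.Unary.Linked using (Linked)
open import Data.List.Relation.Unary.All using (All)

-- A shape (Ferrers diagram of an integer partition) is given by its list of
-- row lengths (top row first); it is a partition when the rows are weakly
-- decreasing and all positive.
Shape : Set
Shape = List ℕ

IsPartition : Shape → Set
IsPartition λ' = Linked _≥_ λ' × All NonZero λ'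
  where open import Data.Product using (_×_)

size : Shape → ℕ
size = sum

-- A filling of a shape: list of rows, each row a list of entries (left to right).
Filling : Set
Filling = List (List ℕ)

readingWord : Filling → List ℕ
readingWord = concat

shapeOf : Filling → Shape
shapeOf = map length

eqShape : Shape → Shape → Bool
eqShape [] [] = true
eqShape (x ∷ xs) (y ∷ ys) = (x ≡ᵇ y) ∧ eqShape xs ys
eqShape _ _ = false

allᵇ : {A : Set} → (A → Bool) → List A → Bool
allᵇ p [] = true
allᵇ p (x ∷ xs) = p x ∧ allᵇ p xs

increasing : List ℕ → Bool
increasing [] = true
increasing (x ∷ []) = true
increasing (x ∷ y ∷ xs) = (x <ᵇ y) ∧ increasing (y ∷ xs)

columnOK : List ℕ → List ℕ → Bool
columnOK _ [] = true
columnOK [] (_ ∷ _) = false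
columnOK (x ∷ xs) (y ∷ ys) = (x <ᵇ y) ∧ columnOK xs ys

columnsIncreasing : Filling → Bool
columnsIncreasing [] = true
columnsIncreasing (r ∷ []) = true
columnsIncreasing (r ∷ s ∷ rs) = columnOK r s ∧ columnsIncreasing (s ∷ rs)

elemᵇ : ℕ → List ℕ → Bool
elemᵇ x [] = false
elemᵇ x (y ∷ ys) = (x ≡ᵇ y) ∨ elemᵇ x ys

distinct : List ℕ → Bool
distinct [] = true
distinct (x ∷ xs) = not (elemᵇ x xs) ∧ distinct xs

isSYT : Shape → Filling → Bool
isSYT λ' T =
  eqShape (shapeOf T) λ'
  ∧ allᵇ (λ x → (1 ≤ᵇ x) ∧ (x ≤ᵇ size λ')) (readingWord T)
  ∧ distinct (readingWord T)
  ∧ allᵇ increasing T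
  ∧ columnsIncreasing T

-- chess colouring: square (r,c) black iff r+c even; chess condition says the
-- entry x is odd iff (r,c) is black, i.e. x + r + c is odd.
-- (Rows/columns are indexed from 0 here; parity of r+c is the same as with
-- 1-based indexing.)
odd : ℕ → Bool
odd zero = false
odd (suc n) = not (odd n)

chessRow : ℕ → ℕ → List ℕ → Bool
chessRow r c [] = true
chessRow r c (x ∷ xs) = odd (x + r + c) ∧ chessRow r (suc c) xs

chessRows : ℕ → Filling → Bool
chessRows r [] = true
chessRows r (row ∷ rows) = chessRow r 0 row ∧ chessRows (suc r) rows

isChess : Filling → Bool
isChess = chessRows 0

isSCT : Shape → Filling → Bool
isSCT λ' T = isSYT λ' T ∧ isChess T

inversions : List ℕ → ℕ
inversions [] = 0
inversions (x ∷ xs) = sum (map (λ y → if y <ᵇ x then 1 else 0) xs) + inversions xs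

sgnWord : List ℕ → ℤ
sgnWord w = -1ℤ ^ inversions w

sgn : Filling → ℤ
sgn T = sgnWord (readingWord T)

words : ℕ → List ℕ → List (List ℕ)
words zero vs = [] ∷ []
words (suc k) vs = concatMap (λ x → map (x ∷_) (words k vs)) vs

fillingsOver : Shape → List ℕ → List Filling
fillingsOver [] vs = [] ∷ []
fillingsOver (k ∷ ks) vs = concatMap (λ r → map (r ∷_) (fillingsOver ks vs)) (words k vs)

-- every filling of λ with entries in {1,…,|λ|}; a finite superset of SYT(λ)
fillings : Shape → List Filling
fillings λ' = fillingsOver λ' (map suc (upTo (size λ')))

sumWhere : {A : Set} → (A → Bool) → (A → ℤ) → List A → ℤ
sumWhere p f [] = 0ℤ
sumWhere p f (x ∷ xs) = (if p x then f x else 0ℤ) +ℤ sumWhere p f xs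

I : Shape → ℤ
I λ' = sumWhere (isSYT λ') sgn (fillings λ')

chessSum : Shape → ℤ
chessSum λ' = sumWhere (isSCT λ') sgn (fillings λ')

-- Colour every value of a standard Young tableau by the colour of its square. The value 1
-- sits in the black corner, so a tableau is a chess tableau exactly when the values j + 1 and
-- j + 2 have different colours for every j. For a non-chess tableau take the least j for which
-- they agree: as neighbouring squares have opposite colours, j + 1 and j + 2 are not
-- neighbours, so exchanging them yields a standard Young tableau with the same colour pattern,
-- hence the same least j. Exchanging two consecutive values changes the number of inversions
-- of the reading word by one, so this involution reverses signs and the non-chess tableaux
-- contribute nothing to I_λ.
module Submission where

open import Defs
open import Data.Bool using (Bool; true; false; _∧_; _∨_; not; _xor_; if_then_else_; T)
open import Data.Bool.ListAction using (any; or)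
open import Data.Bool.Properties using (T-∧; ∧-assoc; not-¬; not-distribˡ-xor; xor-inverseʳ)
open import Data.Empty using (⊥; ⊥-elim)
open import Data.Integer using (ℤ; 0ℤ; +0; -1ℤ; -_; _*_; _^_) renaming (_+_ to _+ℤ_)
open import Data.List using (List; []; _∷_; _++_; [_]; map; foldr; concatMap; length; upTo; applyUpTo; iterate)
open import Data.List.Membership.Propositional using (_∈_; find; lose)
open import Data.List.Membership.Propositional.Properties
  using (∈-∃++; ∈-++⁻; ∈-++⁺ˡ; ∈-++⁺ʳ; ∈-map⁺; ∈-map⁻; ∈-upTo⁺; ∈-upTo⁻)
open import Data.List.Properties
  using (map-∘; map-cong; map-id; map-++; concat-map; map-applyUpTo; upTo-∷ʳ; concatMap-cong; concatMap-map
        ; map-concatMap; length-++; length-++-sucʳ; length-map; length-upTo)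
open import Data.List.Relation.Binary.BagAndSetEquality using (>>=-cong; ↭⇒∼bag; ∼bag⇒↭)
open import Data.List.Relation.Binary.Permutation.Propositional
  using (_↭_; ↭-refl; ↭-prep; ↭-swap; ↭⇒↭ₛ)
open import Data.List.Relation.Binary.Permutation.Propositional.Properties using (map⁺)
open import Data.List.Relation.Binary.Permutation.Setoid.Properties using (foldr-commMonoid)
open import Data.List.Relation.Unary.Any using (here; there)
open import Data.List.Relation.Unary.Any.Properties using (any⁺; any⁻)
open import Data.Nat using (ℕ; zero; suc; pred; _+_; _≤_; _<_; z≤n; s≤s; _≡ᵇ_; _<ᵇ_; _≤ᵇ_; _≟_)
open import Data.Nat.ListAction using (sum)
open import Data.Nat.Properties
  using (+-identityʳ; +-comm; +-assoc; +-suc; +-commutativeSemigroup; 1+n≢n; n<1+n; n≤1+n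
        ; ≤-refl; ≤-trans; ≤-reflexive; ≤-pred; <-irrefl; <-asym; <-trans; ≤-<-trans; <-≤-trans
        ; <⇒≤; <⇒≢; <⇒≱; ≤∧≢⇒<; m≤n⇒m<n∨m≡n
        ; ≡ᵇ⇒≡; ≡⇒≡ᵇ; <ᵇ⇒<; <⇒<ᵇ; ≤ᵇ⇒≤; ≤⇒≤ᵇ)
import Data.Integer.Properties as ℤP
open import Algebra.Properties.CommutativeSemigroup +-commutativeSemigroup using (interchange)
open import Algebra.Properties.CommutativeSemigroup ℤP.+-commutativeSemigroup
  using () renaming (interchange to +ℤ-interchange)
open import Data.Product using (_×_; _,_; proj₁; proj₂; Σ; map₁)
open import Data.Sum using (inj₁; inj₂)
open import Data.Unit using (⊤; tt)
open import Function using (_∘_; id)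
open import Function.Bundles using (Equivalence)
open import Relation.Nullary using (¬_; yes; no)
open import Relation.Nullary.Reflects using (Reflects; ofʸ; ofⁿ; fromEquivalence)
open import Relation.Binary.PropositionalEquality hiding ([_])

private variable A B : Set

T-∧⁻ : ∀ {a b} → T (a ∧ b) → T a × T b
T-∧⁻ = Equivalence.to T-∧

T-∧⁺ : ∀ {a b} → T a → T b → T (a ∧ b)
T-∧⁺ ta tb = Equivalence.from T-∧ (ta , tb)

T-not⇒¬T : ∀ {b} → T (not b) → ¬ T b
T-not⇒¬T {false} _ ()

¬T⇒T-not : ∀ {b} → ¬ T b → T (not b)
¬T⇒T-not {false} _  = _
¬T⇒T-not {true}  ¬t = ¬t _

¬T-not⇒T : ∀ {b} → ¬ T (not b) → T b
¬T-not⇒T {false} ¬t = ¬t _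
¬T-not⇒T {true}  _  = _

≡true⇒T : ∀ {b} → b ≡ true → T b
≡true⇒T refl = _

T⇒≢false : ∀ {b} → T b → b ≢ false
T⇒≢false t refl = t

T-extensional : ∀ {a b} → (T a → T b) → (T b → T a) → a ≡ b
T-extensional {false} {false} _   _   = refl
T-extensional {false} {true}  _   b⇒a = ⊥-elim (b⇒a _)
T-extensional {true}  {false} a⇒b _   = ⊥-elim (a⇒b _)
T-extensional {true}  {true}  _   _   = refl

T-xor⇒≡not : ∀ {a b} → T (a xor b) → b ≡ not a
T-xor⇒≡not {false} {true}  _ = refl
T-xor⇒≡not {true}  {false} _ = refl

T-not-xor⇒≡ : ∀ {a b} → T (not (a xor b)) → a ≡ b
T-not-xor⇒≡ {false} {false} _ = refl
T-not-xor⇒≡ {true}  {true}  _ = refl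

≡ᵇ-reflects-≡ : ∀ m n → Reflects (m ≡ n) (m ≡ᵇ n)
≡ᵇ-reflects-≡ m n = fromEquivalence (≡ᵇ⇒≡ m n) (≡⇒≡ᵇ m n)

≡ᵇ-refl : ∀ n → (n ≡ᵇ n) ≡ true
≡ᵇ-refl zero    = refl
≡ᵇ-refl (suc n) = ≡ᵇ-refl n

≢⇒≡ᵇ-false : ∀ {m n} → m ≢ n → (m ≡ᵇ n) ≡ false
≢⇒≡ᵇ-false {zero}  {zero}  m≢n = ⊥-elim (m≢n refl)
≢⇒≡ᵇ-false {zero}  {suc n} _   = refl
≢⇒≡ᵇ-false {suc m} {zero}  _   = refl
≢⇒≡ᵇ-false {suc m} {suc n} m≢n = ≢⇒≡ᵇ-false (m≢n ∘ cong suc)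

<ᵇ-irrefl : ∀ n → (n <ᵇ n) ≡ false
<ᵇ-irrefl zero    = refl
<ᵇ-irrefl (suc n) = <ᵇ-irrefl n

n<ᵇ1+n : ∀ n → (n <ᵇ suc n) ≡ true
n<ᵇ1+n zero    = refl
n<ᵇ1+n (suc n) = n<ᵇ1+n n

1+n<ᵇn : ∀ n → (suc n <ᵇ n) ≡ false
1+n<ᵇn zero    = refl
1+n<ᵇn (suc n) = 1+n<ᵇn n

<ᵇ-sucʳ : ∀ {m n} → m ≢ n → (m <ᵇ suc n) ≡ (m <ᵇ n)
<ᵇ-sucʳ {zero}  {zero}  m≢n = ⊥-elim (m≢n refl)
<ᵇ-sucʳ {zero}  {suc n} _   = refl
<ᵇ-sucʳ {suc m} {zero}  _   = refl
<ᵇ-sucʳ {suc m} {suc n} m≢n = <ᵇ-sucʳ (m≢n ∘ cong suc)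

<ᵇ-sucˡ : ∀ {m n} → n ≢ suc m → (suc m <ᵇ n) ≡ (m <ᵇ n)
<ᵇ-sucˡ {m} {zero}  _     = refl
<ᵇ-sucˡ {m} {suc n} n≢1+m = sym (<ᵇ-sucʳ (n≢1+m ∘ cong suc ∘ sym))

allᵇ-∈ : ∀ {p : A → Bool} {x} xs → T (allᵇ p xs) → x ∈ xs → T (p x)
allᵇ-∈ (y ∷ ys) all-p (here refl)  = proj₁ (T-∧⁻ all-p)
allᵇ-∈ (y ∷ ys) all-p (there x∈ys) = allᵇ-∈ ys (proj₂ (T-∧⁻ all-p)) x∈ys

allᵇ-intro : ∀ {p : A → Bool} xs → (∀ {x} → x ∈ xs → T (p x)) → T (allᵇ p xs)
allᵇ-intro []       _   = _
allᵇ-intro (x ∷ xs) all = T-∧⁺ (all (here refl)) (allᵇ-intro xs (all ∘ there))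

allᵇ-++ : ∀ (p : A → Bool) xs ys → allᵇ p (xs ++ ys) ≡ allᵇ p xs ∧ allᵇ p ys
allᵇ-++ p []       ys = refl
allᵇ-++ p (x ∷ xs) ys = trans (cong (p x ∧_) (allᵇ-++ p xs ys)) (sym (∧-assoc (p x) _ _))

any-++ : ∀ (p : A → Bool) xs ys → any p (xs ++ ys) ≡ any p xs ∨ any p ys
any-++ p []       ys = refl
any-++ p (x ∷ xs) ys with p x
... | true  = refl
... | false = any-++ p xs ys

∑ : List A → (A → ℤ) → ℤ
∑ xs f = foldr _+ℤ_ 0ℤ (map f xs)

∑-if : ∀ (p : A → Bool) f xs → ∑ xs (λ x → if p x then f x else 0ℤ) ≡ sumWhere p f xs
∑-if p f []       = refl
∑-if p f (x ∷ xs) = cong ((if p x then f x else 0ℤ) +ℤ_) (∑-if p f xs)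

∑-cong : ∀ xs {f g : A → ℤ} → (∀ x → f x ≡ g x) → ∑ xs f ≡ ∑ xs g
∑-cong xs f≗g = cong (foldr _+ℤ_ 0ℤ) (map-cong f≗g xs)

∑-map : ∀ (g : A → B) xs (f : B → ℤ) → ∑ (map g xs) f ≡ ∑ xs (f ∘ g)
∑-map g xs f = cong (foldr _+ℤ_ 0ℤ) (sym (map-∘ xs))

∑-↭ : ∀ {xs ys} (f : A → ℤ) → xs ↭ ys → ∑ xs f ≡ ∑ ys f
∑-↭ f xs↭ys = foldr-commMonoid (setoid ℤ) ℤP.+-0-isCommutativeMonoid (↭⇒↭ₛ (map⁺ f xs↭ys))

∑-++ : ∀ xs ys (f : A → ℤ) → ∑ (xs ++ ys) f ≡ ∑ xs f +ℤ ∑ ys f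
∑-++ []       ys f = sym (ℤP.+-identityˡ _)
∑-++ (x ∷ xs) ys f = trans (cong (f x +ℤ_) (∑-++ xs ys f)) (sym (ℤP.+-assoc (f x) _ _))

∑-+ : ∀ xs (f g : A → ℤ) → ∑ xs (λ x → f x +ℤ g x) ≡ ∑ xs f +ℤ ∑ xs g
∑-+ []       f g = refl
∑-+ (x ∷ xs) f g = trans (cong (f x +ℤ g x +ℤ_) (∑-+ xs f g)) (+ℤ-interchange (f x) (g x) _ _)

∑-neg : ∀ xs (f : A → ℤ) → ∑ xs (λ x → - f x) ≡ - ∑ xs f
∑-neg []       f = refl
∑-neg (x ∷ xs) f = trans (cong (- f x +ℤ_) (∑-neg xs f)) (sym (ℤP.neg-distrib-+ (f x) _))

∑-zero : ∀ xs {f : A → ℤ} → (∀ {x} → x ∈ xs → f x ≡ 0ℤ) → ∑ xs f ≡ 0ℤ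
∑-zero []       _   = refl
∑-zero (x ∷ xs) f≡0 = cong₂ _+ℤ_ (f≡0 (here refl)) (∑-zero xs (f≡0 ∘ there))

∑-comm : ∀ xs ys (f : A → B → ℤ) →
  ∑ xs (λ x → ∑ ys (f x)) ≡ ∑ ys (λ y → ∑ xs (λ x → f x y))
∑-comm []       ys f = sym (∑-zero ys (λ _ → refl))
∑-comm (x ∷ xs) ys f =
  trans (cong (∑ ys (f x) +ℤ_) (∑-comm xs ys f)) (sym (∑-+ ys (f x) (λ y → ∑ xs (λ x → f x y))))

x≡-x⇒x≡0 : ∀ {x} → x ≡ - x → x ≡ 0ℤ
x≡-x⇒x≡0 {+0} _ = refl

∑-sign-reversing : ∀ (τ : A → A) {xs} (f : A → ℤ) →
  map τ xs ↭ xs → (∀ x → f (τ x) ≡ - f x) → ∑ xs f ≡ 0ℤ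
∑-sign-reversing τ {xs} f τxs↭xs f∘τ≡-f = x≡-x⇒x≡0 (begin
  ∑ xs f               ≡⟨ ∑-↭ f τxs↭xs ⟨
  ∑ (map τ xs) f       ≡⟨ ∑-map τ xs f ⟩
  ∑ xs (f ∘ τ)         ≡⟨ ∑-cong xs f∘τ≡-f ⟩
  ∑ xs (λ x → - f x)   ≡⟨ ∑-neg xs f ⟩
  - ∑ xs f             ∎)
  where open ≡-Reasoning

isFirst : (ℕ → Bool) → ℕ → Bool
isFirst p j = p j ∧ not (any p (upTo j))

isFirst-cong : ∀ {p q : ℕ → Bool} → (∀ j → p j ≡ q j) → ∀ j → isFirst p j ≡ isFirst q j
isFirst-cong p≗q j = cong₂ (λ a b → a ∧ not b) (p≗q j) (cong or (map-cong p≗q (upTo j)))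

∑-isFirst : ∀ (p : ℕ → Bool) (a : ℤ) k →
  ∑ (upTo k) (λ j → if isFirst p j then a else 0ℤ) ≡ (if any p (upTo k) then a else 0ℤ)
∑-isFirst p a zero    = refl
∑-isFirst p a (suc k) = begin
  ∑ (upTo (suc k)) first                        ≡⟨ cong (λ js → ∑ js first) (upTo-∷ʳ k) ⟨
  ∑ (upTo k ++ [ k ]) first                     ≡⟨ ∑-++ (upTo k) [ k ] first ⟩
  ∑ (upTo k) first +ℤ (first k +ℤ 0ℤ)           ≡⟨ cong (_+ℤ (first k +ℤ 0ℤ)) (∑-isFirst p a k) ⟩
  indicator (any p (upTo k)) +ℤ (first k +ℤ 0ℤ) ≡⟨ new-witness (any p (upTo k)) (p k) ⟩
  indicator (any p (upTo k) ∨ (p k ∨ false))    ≡⟨ cong indicator (any-++ p (upTo k) [ k ]) ⟨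
  indicator (any p (upTo k ++ [ k ]))           ≡⟨ cong (indicator ∘ any p) (upTo-∷ʳ k) ⟩
  indicator (any p (upTo (suc k)))              ∎
  where
  open ≡-Reasoning
  indicator : Bool → ℤ
  indicator b = if b then a else 0ℤ
  first : ℕ → ℤ
  first j = indicator (isFirst p j)
  new-witness : ∀ b c → indicator b +ℤ (indicator (c ∧ not b) +ℤ 0ℤ) ≡ indicator (b ∨ (c ∨ false))
  new-witness true  true  = ℤP.+-identityʳ a
  new-witness true  false = ℤP.+-identityʳ a
  new-witness false true  = trans (ℤP.+-identityˡ (a +ℤ 0ℤ)) (ℤP.+-identityʳ a)
  new-witness false false = refl

-- Transposing consecutive values

transpose : ℕ → ℕ → ℕ
transpose i x = if x ≡ᵇ i then suc i else if x ≡ᵇ suc i then i else x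

data Position (i : ℕ) : ℕ → Set where
  at-i      : Position i i
  at-suc-i  : Position i (suc i)
  elsewhere : ∀ {x} → x ≢ i → x ≢ suc i → Position i x

position : ∀ i x → Position i x
position i x with x ≟ i | x ≟ suc i
... | yes refl | _        = at-i
... | no _     | yes refl = at-suc-i
... | no x≢i   | no x≢1+i = elsewhere x≢i x≢1+i

transpose-i : ∀ i → transpose i i ≡ suc i
transpose-i i rewrite ≡ᵇ-refl i = refl

transpose-suc-i : ∀ i → transpose i (suc i) ≡ i
transpose-suc-i i rewrite ≢⇒≡ᵇ-false {suc i} {i} 1+n≢n | ≡ᵇ-refl i = refl

transpose-elsewhere : ∀ {i x} → x ≢ i → x ≢ suc i → transpose i x ≡ x
transpose-elsewhere x≢i x≢1+i rewrite ≢⇒≡ᵇ-false x≢i | ≢⇒≡ᵇ-false x≢1+i = refl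

transpose-involutive : ∀ i x → transpose i (transpose i x) ≡ x
transpose-involutive i x with position i x
... | at-i     rewrite transpose-i i     = transpose-suc-i i
... | at-suc-i rewrite transpose-suc-i i = transpose-i i
... | elsewhere x≢i x≢1+i rewrite transpose-elsewhere x≢i x≢1+i = transpose-elsewhere x≢i x≢1+i

module _ (i : ℕ) where

  private
    t = transpose i

  transpose-< : ∀ {x y} → x < y → ¬ (x ≡ i × y ≡ suc i) → t x < t y
  transpose-< {x} {y} x<y not-pair with position i x | position i y
  ... | at-i     | at-i     = ⊥-elim (<-irrefl refl x<y)
  ... | at-i     | at-suc-i = ⊥-elim (not-pair (refl , refl))
  ... | at-i     | elsewhere y≢i y≢1+i
    rewrite transpose-i i | transpose-elsewhere y≢i y≢1+i = ≤∧≢⇒< x<y (y≢1+i ∘ sym)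
  ... | at-suc-i | at-i     = ⊥-elim (<-asym x<y (n<1+n i))
  ... | at-suc-i | at-suc-i = ⊥-elim (<-irrefl refl x<y)
  ... | at-suc-i | elsewhere y≢i y≢1+i
    rewrite transpose-suc-i i | transpose-elsewhere y≢i y≢1+i = <-trans (n<1+n i) x<y
  ... | elsewhere x≢i x≢1+i | at-i
    rewrite transpose-i i | transpose-elsewhere x≢i x≢1+i = <-trans x<y (n<1+n i)
  ... | elsewhere x≢i x≢1+i | at-suc-i
    rewrite transpose-suc-i i | transpose-elsewhere x≢i x≢1+i = ≤∧≢⇒< (≤-pred x<y) x≢i
  ... | elsewhere x≢i x≢1+i | elsewhere y≢i y≢1+i
    rewrite transpose-elsewhere x≢i x≢1+i | transpose-elsewhere y≢i y≢1+i = x<y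

  ≡ᵇ-transpose : ∀ x y → (x ≡ᵇ t y) ≡ (t x ≡ᵇ y)
  ≡ᵇ-transpose x y with x ≡ᵇ t y | ≡ᵇ-reflects-≡ x (t y) | t x ≡ᵇ y | ≡ᵇ-reflects-≡ (t x) y
  ... | true  | _        | true  | _        = refl
  ... | false | _        | false | _        = refl
  ... | true  | ofʸ x≡ty | false | ofⁿ tx≢y =
    ⊥-elim (tx≢y (trans (cong t x≡ty) (transpose-involutive i y)))
  ... | false | ofⁿ x≢ty | true  | ofʸ tx≡y =
    ⊥-elim (x≢ty (trans (sym (transpose-involutive i x)) (cong t tx≡y)))

  elemᵇ-transpose : ∀ x ys → elemᵇ (t x) (map t ys) ≡ elemᵇ x ys
  elemᵇ-transpose x []       = refl
  elemᵇ-transpose x (y ∷ ys) =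
    cong₂ _∨_ (trans (≡ᵇ-transpose (t x) y) (cong (_≡ᵇ y) (transpose-involutive i x)))
              (elemᵇ-transpose x ys)

  distinct-transpose : ∀ w → distinct (map t w) ≡ distinct w
  distinct-transpose []      = refl
  distinct-transpose (x ∷ w) = cong₂ (λ a b → not a ∧ b) (elemᵇ-transpose x w) (distinct-transpose w)

-- Signs of words

𝟙 : Bool → ℕ
𝟙 b = if b then 1 else 0

countWhere : (ℕ → Bool) → List ℕ → ℕ
countWhere p xs = sum (map (𝟙 ∘ p) xs)

-- inversions (x ∷ xs) reduces to below x xs + inversions xs.
below : ℕ → List ℕ → ℕ
below x = countWhere (_<ᵇ x)

occurrences : ℕ → List ℕ → ℕ
occurrences v = countWhere (v ≡ᵇ_)

orderedPairs : ℕ → ℕ → List ℕ → ℕ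
orderedPairs a b []       = 0
orderedPairs a b (x ∷ xs) = (if a ≡ᵇ x then occurrences b xs else 0) + orderedPairs a b xs

module _ (i : ℕ) where

  private
    t = transpose i

  below-transpose-elsewhere : ∀ {x} → x ≢ i → x ≢ suc i → ∀ ys → below x (map t ys) ≡ below x ys
  below-transpose-elsewhere     x≢i x≢1+i []       = refl
  below-transpose-elsewhere {x} x≢i x≢1+i (y ∷ ys) =
    cong₂ (λ b n → 𝟙 b + n) compare (below-transpose-elsewhere x≢i x≢1+i ys)
    where
    compare : (t y <ᵇ x) ≡ (y <ᵇ x)
    compare with position i y
    ... | at-i     rewrite transpose-i i     = <ᵇ-sucˡ x≢1+i
    ... | at-suc-i rewrite transpose-suc-i i = sym (<ᵇ-sucˡ x≢1+i)
    ... | elsewhere y≢i y≢1+i rewrite transpose-elsewhere y≢i y≢1+i = refl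

  below-transpose-suc-i : ∀ ys → below (suc i) (map t ys) ≡ below i ys + occurrences (suc i) ys
  below-transpose-suc-i []       = refl
  below-transpose-suc-i (y ∷ ys) =
    trans (cong₂ _+_ split (below-transpose-suc-i ys))
          (interchange (𝟙 (y <ᵇ i)) (𝟙 (suc i ≡ᵇ y)) (below i ys) (occurrences (suc i) ys))
    where
    split : 𝟙 (t y <ᵇ suc i) ≡ 𝟙 (y <ᵇ i) + 𝟙 (suc i ≡ᵇ y)
    split with position i y
    ... | at-i     rewrite transpose-i i | <ᵇ-irrefl i | ≢⇒≡ᵇ-false {suc i} {i} 1+n≢n = refl
    ... | at-suc-i rewrite transpose-suc-i i | n<ᵇ1+n i | 1+n<ᵇn i | ≡ᵇ-refl i = refl
    ... | elsewhere y≢i y≢1+i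
      rewrite transpose-elsewhere y≢i y≢1+i | <ᵇ-sucʳ y≢i | ≢⇒≡ᵇ-false (y≢1+i ∘ sym) =
        sym (+-identityʳ _)

  below-transpose-i : ∀ ys → below i (map t ys) + occurrences i ys ≡ below (suc i) ys
  below-transpose-i []       = refl
  below-transpose-i (y ∷ ys) =
    trans (interchange (𝟙 (t y <ᵇ i)) (below i (map t ys)) (𝟙 (i ≡ᵇ y)) (occurrences i ys))
          (cong₂ _+_ merge (below-transpose-i ys))
    where
    merge : 𝟙 (t y <ᵇ i) + 𝟙 (i ≡ᵇ y) ≡ 𝟙 (y <ᵇ suc i)
    merge with position i y
    ... | at-i     rewrite transpose-i i | 1+n<ᵇn i | ≡ᵇ-refl i | n<ᵇ1+n i = refl
    ... | at-suc-i rewrite transpose-suc-i i | <ᵇ-irrefl i | ≢⇒≡ᵇ-false {i} {suc i} (1+n≢n ∘ sym) = refl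
    ... | elsewhere y≢i y≢1+i
      rewrite transpose-elsewhere y≢i y≢1+i | <ᵇ-sucʳ y≢i | ≢⇒≡ᵇ-false (y≢i ∘ sym) = +-identityʳ _

  inversions-transpose : ∀ w →
    inversions (map t w) + orderedPairs (suc i) i w ≡ inversions w + orderedPairs i (suc i) w
  inversions-transpose []       = refl
  inversions-transpose (x ∷ xs) = step (position i x)
    where
    open ≡-Reasoning
    v′ = inversions (map t xs)
    v  = inversions xs
    P  = orderedPairs (suc i) i xs
    Q  = orderedPairs i (suc i) xs
    ih : v′ + P ≡ v + Q
    ih = inversions-transpose xs
    step : ∀ {x} → Position i x →
      inversions (map t (x ∷ xs)) + orderedPairs (suc i) i (x ∷ xs) ≡
      inversions (x ∷ xs) + orderedPairs i (suc i) (x ∷ xs)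
    step at-i
      rewrite transpose-i i | below-transpose-suc-i xs | ≢⇒≡ᵇ-false {suc i} {i} 1+n≢n | ≡ᵇ-refl i = begin
        below i xs + o + v′ + P    ≡⟨ +-assoc (below i xs + o) v′ P ⟩
        below i xs + o + (v′ + P)  ≡⟨ cong (below i xs + o +_) ih ⟩
        below i xs + o + (v + Q)   ≡⟨ interchange (below i xs) o v Q ⟩
        below i xs + v + (o + Q)   ∎
      where o = occurrences (suc i) xs
    step at-suc-i
      rewrite transpose-suc-i i | sym (below-transpose-i xs)
            | ≢⇒≡ᵇ-false {i} {suc i} (1+n≢n ∘ sym) | ≡ᵇ-refl i = begin
        c + v′ + (o + P)  ≡⟨ interchange c v′ o P ⟩
        c + o + (v′ + P)  ≡⟨ cong (c + o +_) ih ⟩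
        c + o + (v + Q)   ≡⟨ +-assoc (c + o) v Q ⟨
        c + o + v + Q     ∎
      where c = below i (map t xs); o = occurrences i xs
    step {x} (elsewhere x≢i x≢1+i)
      rewrite transpose-elsewhere x≢i x≢1+i | below-transpose-elsewhere x≢i x≢1+i xs
            | ≢⇒≡ᵇ-false (x≢i ∘ sym) | ≢⇒≡ᵇ-false (x≢1+i ∘ sym) = begin
        below x xs + v′ + P    ≡⟨ +-assoc (below x xs) v′ P ⟩
        below x xs + (v′ + P)  ≡⟨ cong (below x xs +_) ih ⟩
        below x xs + (v + Q)   ≡⟨ +-assoc (below x xs) v Q ⟨
        below x xs + v + Q     ∎

occurrences-absent : ∀ v xs → T (not (elemᵇ v xs)) → occurrences v xs ≡ 0
occurrences-absent v []       _  = refl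
occurrences-absent v (x ∷ xs) v∉ with v ≡ᵇ x
... | false = occurrences-absent v xs v∉

occurrences-unique : ∀ v xs → T (distinct xs) → T (elemᵇ v xs) → occurrences v xs ≡ 1
occurrences-unique v (x ∷ xs) d v∈ with v ≡ᵇ x | ≡ᵇ-reflects-≡ v x
... | true  | ofʸ refl = cong suc (occurrences-absent v xs (proj₁ (T-∧⁻ d)))
... | false | ofⁿ _    = occurrences-unique v xs (proj₂ (T-∧⁻ d)) v∈

orderedPairs-absentˡ : ∀ a b xs → T (not (elemᵇ a xs)) → orderedPairs a b xs ≡ 0
orderedPairs-absentˡ a b []       _  = refl
orderedPairs-absentˡ a b (x ∷ xs) a∉ with a ≡ᵇ x
... | false = orderedPairs-absentˡ a b xs a∉

orderedPairs-absentʳ : ∀ a b xs → T (not (elemᵇ b xs)) → orderedPairs a b xs ≡ 0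
orderedPairs-absentʳ a b []       _  = refl
orderedPairs-absentʳ a b (x ∷ xs) b∉ with b ≡ᵇ x
... | false rewrite occurrences-absent b xs b∉ | orderedPairs-absentʳ a b xs b∉ with a ≡ᵇ x
...   | true  = refl
...   | false = refl

orderedPairs-total : ∀ a b xs → a ≢ b → T (distinct xs) → T (elemᵇ a xs) → T (elemᵇ b xs) →
  orderedPairs a b xs + orderedPairs b a xs ≡ 1
orderedPairs-total a b (x ∷ xs) a≢b d a∈ b∈
  with a ≡ᵇ x | ≡ᵇ-reflects-≡ a x | b ≡ᵇ x | ≡ᵇ-reflects-≡ b x
... | true  | ofʸ refl | true  | ofʸ refl = ⊥-elim (a≢b refl)
... | true  | ofʸ refl | false | ofⁿ _
  rewrite occurrences-unique b xs (proj₂ (T-∧⁻ d)) b∈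
        | orderedPairs-absentˡ a b xs (proj₁ (T-∧⁻ d))
        | orderedPairs-absentʳ b a xs (proj₁ (T-∧⁻ d)) = refl
... | false | ofⁿ _    | true  | ofʸ refl
  rewrite occurrences-unique a xs (proj₂ (T-∧⁻ d)) a∈
        | orderedPairs-absentʳ a b xs (proj₁ (T-∧⁻ d))
        | orderedPairs-absentˡ b a xs (proj₁ (T-∧⁻ d)) = refl
... | false | ofⁿ _    | false | ofⁿ _    = orderedPairs-total a b xs a≢b (proj₂ (T-∧⁻ d)) a∈ b∈

-1^-flip : ∀ {m n x y} → m + x ≡ n + y → x + y ≡ 1 → -1ℤ ^ m ≡ - (-1ℤ ^ n)
-1^-flip {m} {n} {zero} {suc zero} m+0≡n+1 _ = begin
  -1ℤ ^ m        ≡⟨ cong (-1ℤ ^_) (trans (sym (+-identityʳ m)) (trans m+0≡n+1 (+-comm n 1))) ⟩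
  -1ℤ * -1ℤ ^ n  ≡⟨ ℤP.-1*i≡-i (-1ℤ ^ n) ⟩
  - (-1ℤ ^ n)    ∎
  where open ≡-Reasoning
-1^-flip {m} {n} {suc zero} {zero} m+1≡n+0 _ = begin
  -1ℤ ^ m            ≡⟨ ℤP.neg-involutive (-1ℤ ^ m) ⟨
  - - (-1ℤ ^ m)      ≡⟨ cong -_ (ℤP.-1*i≡-i (-1ℤ ^ m)) ⟨
  - (-1ℤ * -1ℤ ^ m)  ≡⟨ cong (-_ ∘ (-1ℤ ^_)) (trans (+-comm 1 m) (trans m+1≡n+0 (+-identityʳ n))) ⟩
  - (-1ℤ ^ n)        ∎
  where open ≡-Reasoning

sgnWord-transpose : ∀ i w → T (distinct w) → T (elemᵇ i w) → T (elemᵇ (suc i) w) →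
  sgnWord (map (transpose i) w) ≡ - sgnWord w
sgnWord-transpose i w d i∈w 1+i∈w =
  -1^-flip {x = orderedPairs (suc i) i w} (inversions-transpose i w)
           (orderedPairs-total (suc i) i w 1+n≢n d 1+i∈w i∈w)

concatMap-↭ : ∀ {f g : A → List B} {xs ys} → xs ↭ ys → (∀ x → f x ↭ g x) →
  concatMap f xs ↭ concatMap g ys
concatMap-↭ xs↭ys f↭g = ∼bag⇒↭ (>>=-cong (↭⇒∼bag xs↭ys) (↭⇒∼bag ∘ f↭g))

-- words and fillingsOver unfold definitionally to iterated cartesian products.
cartesian : List A → List (List A) → List (List A)
cartesian xs yss = concatMap (λ x → map (x ∷_) yss) xs

cartesian-↭ : ∀ {xs xs′ : List A} {yss yss′} → xs ↭ xs′ → yss ↭ yss′ →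
  cartesian xs yss ↭ cartesian xs′ yss′
cartesian-↭ xs↭xs′ yss↭yss′ = concatMap-↭ xs↭xs′ (λ x → map⁺ (x ∷_) yss↭yss′)

map-cartesian : ∀ (f : A → B) xs yss →
  map (map f) (cartesian xs yss) ≡ cartesian (map f xs) (map (map f) yss)
map-cartesian f xs yss = begin
  map (map f) (concatMap (λ x → map (x ∷_) yss) xs)          ≡⟨ map-concatMap (map f) _ xs ⟩
  concatMap (λ x → map (map f) (map (x ∷_) yss)) xs          ≡⟨ concatMap-cong map-cons xs ⟩
  concatMap (λ x → map (f x ∷_) (map (map f) yss)) xs        ≡⟨ concatMap-map _ f xs ⟨
  concatMap (λ y → map (y ∷_) (map (map f) yss)) (map f xs)  ∎
  where
  open ≡-Reasoning
  map-cons : ∀ x → map (map f) (map (x ∷_) yss) ≡ map (f x ∷_) (map (map f) yss)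
  map-cons x = trans (sym (map-∘ yss)) (map-∘ yss)

words-↭ : ∀ k {vs ws : List ℕ} → vs ↭ ws → words k vs ↭ words k ws
words-↭ zero    vs↭ws = ↭-refl
words-↭ (suc k) vs↭ws = cartesian-↭ vs↭ws (words-↭ k vs↭ws)

fillingsOver-↭ : ∀ ks {vs ws} → vs ↭ ws → fillingsOver ks vs ↭ fillingsOver ks ws
fillingsOver-↭ []       vs↭ws = ↭-refl
fillingsOver-↭ (k ∷ ks) vs↭ws = cartesian-↭ (words-↭ k vs↭ws) (fillingsOver-↭ ks vs↭ws)

words-map : ∀ k (f : ℕ → ℕ) vs → words k (map f vs) ≡ map (map f) (words k vs)
words-map zero    f vs = refl
words-map (suc k) f vs =
  trans (cong (cartesian (map f vs)) (words-map k f vs)) (sym (map-cartesian f vs (words k vs)))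

fillingsOver-map : ∀ ks (f : ℕ → ℕ) vs →
  fillingsOver ks (map f vs) ≡ map (map (map f)) (fillingsOver ks vs)
fillingsOver-map []       f vs = refl
fillingsOver-map (k ∷ ks) f vs =
  trans (cong₂ cartesian (words-map k f vs) (fillingsOver-map ks f vs))
        (sym (map-cartesian (map f) (words k vs) (fillingsOver ks vs)))

applyUpTo-iterate : ∀ n j (f : ℕ → ℕ) → (∀ k → f k ≡ j + k) → applyUpTo f n ≡ iterate suc j n
applyUpTo-iterate zero    j f f≗j+ = refl
applyUpTo-iterate (suc n) j f f≗j+ =
  cong₂ _∷_ (trans (f≗j+ 0) (+-identityʳ j))
            (applyUpTo-iterate n (suc j) (f ∘ suc) (λ k → trans (f≗j+ (suc k)) (+-suc j k)))

module _ (i : ℕ) where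

  private
    t = transpose i

  transpose-iterate-above : ∀ n {j} → suc i < j → map t (iterate suc j n) ≡ iterate suc j n
  transpose-iterate-above zero    _     = refl
  transpose-iterate-above (suc n) 1+i<j =
    cong₂ _∷_ (transpose-elsewhere (<⇒≢ (<-trans (n<1+n i) 1+i<j) ∘ sym) (<⇒≢ 1+i<j ∘ sym))
              (transpose-iterate-above n (<-trans 1+i<j (n<1+n _)))

  transpose-iterate : ∀ n {j} → j ≤ i → suc i < j + n → map t (iterate suc j n) ↭ iterate suc j n
  transpose-iterate zero {j} j≤i 1+i<j+0 =
    ⊥-elim (<-irrefl refl (<-trans (n<1+n i) (<-≤-trans (subst (suc i <_) (+-identityʳ j) 1+i<j+0) j≤i)))
  transpose-iterate (suc n) {j} j≤i 1+i<j+n with m≤n⇒m<n∨m≡n j≤i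
  ... | inj₁ j<i rewrite transpose-elsewhere (<⇒≢ j<i) (<⇒≢ (<-trans j<i (n<1+n i))) =
    ↭-prep j (transpose-iterate n j<i (subst (suc i <_) (+-suc j n) 1+i<j+n))
  transpose-iterate (suc zero)    _ 1+i<i+1 | inj₂ refl = ⊥-elim (<-irrefl (sym (+-comm i 1)) 1+i<i+1)
  transpose-iterate (suc (suc n)) _ _       | inj₂ refl
    rewrite transpose-i i | transpose-suc-i i | transpose-iterate-above n (n<1+n (suc i)) =
    ↭-swap (suc i) i ↭-refl

alphabet-transpose : ∀ {N i} → 1 ≤ i → suc i ≤ N →
  map (transpose i) (map suc (upTo N)) ↭ map suc (upTo N)
alphabet-transpose {N} {i} 1≤i 1+i≤N
  rewrite map-applyUpTo id suc N | applyUpTo-iterate N 1 suc (λ _ → refl) =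
  transpose-iterate i N 1≤i (s≤s 1+i≤N)

τ : ℕ → Filling → Filling
τ i = map (map (transpose i))

τ-involutive : ∀ i F → τ i (τ i F) ≡ F
τ-involutive i F = trans (sym (map-∘ F)) (trans (map-cong row-involutive F) (map-id F))
  where
  row-involutive : ∀ r → map (transpose i) (map (transpose i) r) ≡ r
  row-involutive r = trans (sym (map-∘ r)) (trans (map-cong (transpose-involutive i) r) (map-id r))

fillings-τ : ∀ λ' {i} → 1 ≤ i → suc i ≤ size λ' → map (τ i) (fillings λ') ↭ fillings λ'
fillings-τ λ' {i} 1≤i 1+i≤N =
  subst (_↭ fillings λ') (fillingsOver-map λ' (transpose i) (map suc (upTo (size λ'))))
        (fillingsOver-↭ λ' (alphabet-transpose 1≤i 1+i≤N))

elemᵇ-complete : ∀ {x xs} → x ∈ xs → T (elemᵇ x xs)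
elemᵇ-complete {x} {y ∷ ys} x∈ with x ≡ᵇ y | ≡ᵇ-reflects-≡ x y | x∈
... | true  | _     | _           = _
... | false | ofⁿ _ | there x∈ys  = elemᵇ-complete x∈ys
... | false | ofⁿ x≢y | here x≡y  = ⊥-elim (x≢y x≡y)

elemᵇ-sound : ∀ {x} xs → T (elemᵇ x xs) → x ∈ xs
elemᵇ-sound {x} (y ∷ ys) x∈ with x ≡ᵇ y | ≡ᵇ-reflects-≡ x y
... | true  | ofʸ x≡y = here x≡y
... | false | ofⁿ _   = there (elemᵇ-sound ys x∈)

distinct⇒length≤ : ∀ w {S : List ℕ} → T (distinct w) → (∀ {x} → x ∈ w → x ∈ S) →
  length w ≤ length S
distinct⇒length≤ []      _ _    = z≤n
distinct⇒length≤ (x ∷ w) d w⊆S with ∈-∃++ (w⊆S (here refl))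
... | A , B , refl =
  subst (suc (length w) ≤_) (sym (length-++-sucʳ A x B))
        (s≤s (distinct⇒length≤ w (proj₂ (T-∧⁻ d)) w⊆A++B))
  where
  w⊆A++B : ∀ {y} → y ∈ w → y ∈ A ++ B
  w⊆A++B y∈w with ∈-++⁻ A (w⊆S (there y∈w))
  ... | inj₁ y∈A         = ∈-++⁺ˡ y∈A
  ... | inj₂ (there y∈B) = ∈-++⁺ʳ A y∈B
  ... | inj₂ (here refl) = ⊥-elim (T-not⇒¬T (proj₁ (T-∧⁻ d)) (elemᵇ-complete y∈w))

distinct⇒complete : ∀ w {S : List ℕ} → T (distinct w) → length S ≤ length w →
  (∀ {x} → x ∈ w → x ∈ S) → ∀ {v} → v ∈ S → T (elemᵇ v w)
distinct⇒complete w {S} d S≤w w⊆S {v} v∈S with elemᵇ v w in v∉w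
... | true  = _
... | false = ⊥-elim (<-irrefl refl (≤-trans (distinct⇒length≤ (v ∷ w) v∷w-distinct v∷w⊆S) S≤w))
  where
  v∷w-distinct : T (distinct (v ∷ w))
  v∷w-distinct = subst (λ b → T (not b ∧ distinct w)) (sym v∉w) d
  v∷w⊆S : ∀ {x} → x ∈ v ∷ w → x ∈ S
  v∷w⊆S (here refl) = v∈S
  v∷w⊆S (there x∈w) = w⊆S x∈w

-- An entry together with the colour odd (r + c) of its square r, c: true means white.
Cell : Set
Cell = ℕ × Bool

rowCells : ℕ → ℕ → List ℕ → List Cell
rowCells r c []       = []
rowCells r c (x ∷ xs) = (x , odd (r + c)) ∷ rowCells r (suc c) xs

cellsFrom : ℕ → Filling → List Cell
cellsFrom r []           = []
cellsFrom r (row ∷ rows) = rowCells r 0 row ++ cellsFrom (suc r) rows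

cells : Filling → List Cell
cells = cellsFrom 0

-- The colour of the first cell holding v, and black (false) when v does not occur.
colour : ℕ → List Cell → Bool
colour v []             = false
colour v ((x , b) ∷ cs) = if v ≡ᵇ x then b else colour v cs

module _ (f : ℕ → ℕ) where

  rowCells-map : ∀ r c xs → rowCells r c (map f xs) ≡ map (map₁ f) (rowCells r c xs)
  rowCells-map r c []       = refl
  rowCells-map r c (x ∷ xs) = cong (_ ∷_) (rowCells-map r (suc c) xs)

  cellsFrom-map : ∀ r F → cellsFrom r (map (map f) F) ≡ map (map₁ f) (cellsFrom r F)
  cellsFrom-map r []           = refl
  cellsFrom-map r (row ∷ rows) =
    trans (cong₂ _++_ (rowCells-map r 0 row) (cellsFrom-map (suc r) rows))
          (sym (map-++ (map₁ f) (rowCells r 0 row) _))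

rowCells-entries : ∀ r c xs → map proj₁ (rowCells r c xs) ≡ xs
rowCells-entries r c []       = refl
rowCells-entries r c (x ∷ xs) = cong (x ∷_) (rowCells-entries r (suc c) xs)

cellsFrom-entries : ∀ r F → map proj₁ (cellsFrom r F) ≡ readingWord F
cellsFrom-entries r []           = refl
cellsFrom-entries r (row ∷ rows) =
  trans (map-++ proj₁ (rowCells r 0 row) _)
        (cong₂ _++_ (rowCells-entries r 0 row) (cellsFrom-entries (suc r) rows))

∈-rowCells⇒∈ : ∀ {x b} r c xs → (x , b) ∈ rowCells r c xs → x ∈ xs
∈-rowCells⇒∈ r c xs xb∈ = subst (_ ∈_) (rowCells-entries r c xs) (∈-map⁺ proj₁ xb∈)

∈-cellsFrom⇒∈ : ∀ {x b} r F → (x , b) ∈ cellsFrom r F → x ∈ readingWord F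
∈-cellsFrom⇒∈ r F xb∈ = subst (_ ∈_) (cellsFrom-entries r F) (∈-map⁺ proj₁ xb∈)

colour-∈ : ∀ {v b} C → T (distinct (map proj₁ C)) → (v , b) ∈ C → colour v C ≡ b
colour-∈ {v} ((x , b′) ∷ C) d vb∈ with v ≡ᵇ x | ≡ᵇ-reflects-≡ v x | vb∈
... | true  | ofʸ refl | here refl  = refl
... | true  | ofʸ refl | there vb∈C =
  ⊥-elim (T-not⇒¬T (proj₁ (T-∧⁻ d)) (elemᵇ-complete (∈-map⁺ proj₁ vb∈C)))
... | false | ofⁿ v≢x  | here refl  = ⊥-elim (v≢x refl)
... | false | ofⁿ _    | there vb∈C = colour-∈ C (proj₂ (T-∧⁻ d)) vb∈C

HeadAtLeast : ℕ → List ℕ → Set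
HeadAtLeast m []      = ⊤
HeadAtLeast m (h ∷ _) = m ≤ h

increasing⇒head< : ∀ {z} h t → T (increasing (h ∷ t)) → z ∈ t → h < z
increasing⇒head< h (y ∷ t) inc (here refl) = <ᵇ⇒< h y (proj₁ (T-∧⁻ inc))
increasing⇒head< h (y ∷ t) inc (there z∈t) =
  <-trans (<ᵇ⇒< h y (proj₁ (T-∧⁻ inc))) (increasing⇒head< y t (proj₂ (T-∧⁻ {a = h <ᵇ y} inc)) z∈t)

increasing⇒≥head : ∀ {m z} row → HeadAtLeast m row → T (increasing row) → z ∈ row → m ≤ z
increasing⇒≥head (h ∷ t) m≤h inc (here refl) = m≤h
increasing⇒≥head (h ∷ t) m≤h inc (there z∈t) = ≤-trans m≤h (<⇒≤ (increasing⇒head< h t inc z∈t))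

columnOK⇒HeadAtLeast : ∀ {m} r s → HeadAtLeast m r → T (columnOK r s) → HeadAtLeast (suc m) s
columnOK⇒HeadAtLeast r       []      _   _  = tt
columnOK⇒HeadAtLeast (h ∷ t) (y ∷ s) m≤h ok = ≤-<-trans m≤h (<ᵇ⇒< h y (proj₁ (T-∧⁻ ok)))

lower-rows-exceed : ∀ {m z} r rows → HeadAtLeast m r → T (columnsIncreasing (r ∷ rows)) →
  T (allᵇ increasing rows) → z ∈ readingWord rows → m < z
lower-rows-exceed r (s ∷ rows) hd cols rws z∈ with ∈-++⁻ s z∈
... | inj₁ z∈s    = increasing⇒≥head s hd′ (proj₁ (T-∧⁻ rws)) z∈s
  where hd′ = columnOK⇒HeadAtLeast r s hd (proj₁ (T-∧⁻ cols))
... | inj₂ z∈rows =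
  <-trans (n<1+n _) (lower-rows-exceed s rows hd′ (proj₂ (T-∧⁻ {a = columnOK r s} cols))
                                     (proj₂ (T-∧⁻ {a = increasing s} rws)) z∈rows)
  where hd′ = columnOK⇒HeadAtLeast r s hd (proj₁ (T-∧⁻ cols))

least-entry-black : ∀ {m b} F → T (allᵇ increasing F) → T (columnsIncreasing F) →
  (∀ {x} → x ∈ readingWord F → m ≤ x) → (m , b) ∈ cells F → b ≡ false
least-entry-black ([] ∷ rows) rws cols least mb∈ =
  ⊥-elim (<-irrefl refl (lower-rows-exceed [] rows tt cols (proj₂ (T-∧⁻ rws))
                                            (∈-cellsFrom⇒∈ 1 rows mb∈)))
least-entry-black ((h ∷ t) ∷ rows) rws cols least (here refl) = refl
least-entry-black ((h ∷ t) ∷ rows) rws cols least (there mb∈) with ∈-++⁻ (rowCells 0 1 t) mb∈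
... | inj₁ mb∈t    =
  ⊥-elim (<⇒≱ (increasing⇒head< h t (proj₁ (T-∧⁻ rws)) (∈-rowCells⇒∈ 0 1 t mb∈t))
              (least (here refl)))
... | inj₂ mb∈rows =
  ⊥-elim (<⇒≱ (lower-rows-exceed (h ∷ t) rows ≤-refl cols (proj₂ (T-∧⁻ {a = increasing (h ∷ t)} rws))
                                 (∈-cellsFrom⇒∈ 1 rows mb∈rows)) (least (here refl)))

odd-+ : ∀ m n → odd (m + n) ≡ odd m xor odd n
odd-+ zero    n = refl
odd-+ (suc m) n = trans (cong not (odd-+ m n)) (not-distribˡ-xor (odd m) (odd n))

wellColoured : Cell → Bool
wellColoured (x , b) = odd x xor b

chessRow-cells : ∀ r c xs → chessRow r c xs ≡ allᵇ wellColoured (rowCells r c xs)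
chessRow-cells r c []       = refl
chessRow-cells r c (x ∷ xs) =
  cong₂ _∧_ (trans (cong odd (+-assoc x r c)) (odd-+ x (r + c))) (chessRow-cells r (suc c) xs)

chessRows-cells : ∀ r F → chessRows r F ≡ allᵇ wellColoured (cellsFrom r F)
chessRows-cells r []           = refl
chessRows-cells r (row ∷ rows) =
  trans (cong₂ _∧_ (chessRow-cells r 0 row) (chessRows-cells (suc r) rows))
        (sym (allᵇ-++ wellColoured (rowCells r 0 row) _))

-- Compares the values j + 1 and j + 2, so that j ranges over upTo (pred N).
sameColour : List Cell → ℕ → Bool
sameColour C j = not (colour (suc j) C xor colour (suc (suc j)) C)

<pred⇒2+≤ : ∀ {j N} → j < pred N → suc (suc j) ≤ N
<pred⇒2+≤ {N = suc N} j<N = s≤s j<N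

2+≤⇒<pred : ∀ {j N} → suc (suc j) ≤ N → j < pred N
2+≤⇒<pred (s≤s 2+j≤N) = 2+j≤N

Alternating : ℕ → List Cell → Set
Alternating N C = ∀ {v} → 1 ≤ v → v ≤ N → colour v C ≡ not (odd v)

eqShape-sound : ∀ xs ys → T (eqShape xs ys) → xs ≡ ys
eqShape-sound []       []       _  = refl
eqShape-sound (x ∷ xs) (y ∷ ys) eq =
  cong₂ _∷_ (≡ᵇ⇒≡ x y (proj₁ (T-∧⁻ eq)))
            (eqShape-sound xs ys (proj₂ (T-∧⁻ {a = x ≡ᵇ y} eq)))

length-readingWord : ∀ F → length (readingWord F) ≡ size (shapeOf F)
length-readingWord []      = refl
length-readingWord (r ∷ F) = trans (length-++ r) (cong (length r +_) (length-readingWord F))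

record IsSYT (λ' : Shape) (F : Filling) : Set where
  field
    hasShape        : T (eqShape (shapeOf F) λ')
    inRange         : T (allᵇ (λ x → (1 ≤ᵇ x) ∧ (x ≤ᵇ size λ')) (readingWord F))
    distinctEntries : T (distinct (readingWord F))
    rowsIncrease    : T (allᵇ increasing F)
    columnsIncrease : T (columnsIncreasing F)

isSYT⇒IsSYT : ∀ {λ' F} → T (isSYT λ' F) → IsSYT λ' F
isSYT⇒IsSYT syt =
  let s , syt₁ = T-∧⁻ syt; r , syt₂ = T-∧⁻ syt₁; d , syt₃ = T-∧⁻ syt₂; i , c = T-∧⁻ syt₃
  in record { hasShape = s ; inRange = r ; distinctEntries = d ; rowsIncrease = i ; columnsIncrease = c }

IsSYT⇒isSYT : ∀ {λ' F} → IsSYT λ' F → T (isSYT λ' F)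
IsSYT⇒isSYT syt =
  T-∧⁺ hasShape (T-∧⁺ inRange (T-∧⁺ distinctEntries (T-∧⁺ rowsIncrease columnsIncrease)))
  where open IsSYT syt

module _ {λ' F} (syt : IsSYT λ' F) where
  open IsSYT syt

  private
    N = size λ'
    C = cells F

  length-entries : length (readingWord F) ≡ N
  length-entries = trans (length-readingWord F) (cong size (eqShape-sound (shapeOf F) λ' hasShape))

  entry-bounds : ∀ {x} → x ∈ readingWord F → 1 ≤ x × x ≤ N
  entry-bounds x∈F =
    let lo , hi = T-∧⁻ (allᵇ-∈ (readingWord F) inRange x∈F) in ≤ᵇ⇒≤ 1 _ lo , ≤ᵇ⇒≤ _ N hi

  every-entry-occurs : ∀ {v} → 1 ≤ v → v ≤ N → T (elemᵇ v (readingWord F))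
  every-entry-occurs {suc u} _ v≤N =
    distinct⇒complete (readingWord F) distinctEntries
      (≤-reflexive (trans (length-map suc (upTo N)) (trans (length-upTo N) (sym length-entries))))
      entry∈alphabet (∈-map⁺ suc (∈-upTo⁺ v≤N))
    where
    entry∈alphabet : ∀ {x} → x ∈ readingWord F → x ∈ map suc (upTo N)
    entry∈alphabet x∈F with entry-bounds x∈F
    ... | s≤s z≤n , x≤N = ∈-map⁺ suc (∈-upTo⁺ x≤N)

  cell-of : ∀ {v} → 1 ≤ v → v ≤ N → Σ Bool λ b → (v , b) ∈ C
  cell-of 1≤v v≤N
    with ∈-map⁻ proj₁ (subst (_ ∈_) (sym (cellsFrom-entries 0 F))
                              (elemᵇ-sound _ (every-entry-occurs 1≤v v≤N)))
  ... | (v , b) , vb∈ , refl = b , vb∈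

  colour-cell : ∀ {x b} → (x , b) ∈ C → colour x C ≡ b
  colour-cell = colour-∈ C (subst (T ∘ distinct) (sym (cellsFrom-entries 0 F)) distinctEntries)

  wellColoured⇒Alternating : T (allᵇ wellColoured C) → Alternating N C
  wellColoured⇒Alternating all 1≤v v≤N =
    let b , vb∈ = cell-of 1≤v v≤N in trans (colour-cell vb∈) (T-xor⇒≡not (allᵇ-∈ C all vb∈))

  Alternating⇒wellColoured : Alternating N C → T (allᵇ wellColoured C)
  Alternating⇒wellColoured alt = allᵇ-intro C λ {(x , b)} xb∈ →
    let 1≤x , x≤N = entry-bounds (∈-cellsFrom⇒∈ 0 F xb∈)
    in subst (λ b → T (odd x xor b)) (trans (sym (alt 1≤x x≤N)) (colour-cell xb∈))
             (subst T (sym (xor-inverseʳ (odd x))) _)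

  Alternating⇒no-sameColour : Alternating N C → ¬ T (any (sameColour C) (upTo (pred N)))
  Alternating⇒no-sameColour alt some with find (any⁻ (sameColour C) _ some)
  ... | j , j∈ , same
    rewrite alt (s≤s z≤n) (≤-trans (n≤1+n _) (<pred⇒2+≤ (∈-upTo⁻ j∈)))
          | alt (s≤s z≤n) (<pred⇒2+≤ (∈-upTo⁻ j∈))
          | xor-inverseʳ (not (odd (suc j))) = same

  no-sameColour⇒Alternating : ¬ T (any (sameColour C) (upTo (pred N))) → Alternating N C
  no-sameColour⇒Alternating none {suc zero} _ 1≤N =
    let b , 1b∈ = cell-of ≤-refl 1≤N
    in trans (colour-cell 1b∈)
             (least-entry-black F rowsIncrease columnsIncrease (proj₁ ∘ entry-bounds) 1b∈)
  no-sameColour⇒Alternating none {suc (suc k)} _ 2+k≤N =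
    trans (T-xor⇒≡not (¬T-not⇒T (none ∘ any⁺ (sameColour C) ∘ lose (∈-upTo⁺ (2+≤⇒<pred 2+k≤N)))))
          (cong not (no-sameColour⇒Alternating none (s≤s z≤n) (≤-trans (n≤1+n _) 2+k≤N)))

  isChess≡no-sameColour : isChess F ≡ not (any (sameColour C) (upTo (pred N)))
  isChess≡no-sameColour =
    trans (chessRows-cells 0 F)
          (T-extensional (¬T⇒T-not ∘ Alternating⇒no-sameColour ∘ wellColoured⇒Alternating)
                         (Alternating⇒wellColoured ∘ no-sameColour⇒Alternating ∘ T-not⇒¬T))

-- Exchanging equally coloured values

-- Neighbouring squares have opposite colours, so a separated pair i, i + 1 is never adjacent
-- in a row or in a column.
Separated : ℕ → List Cell → List Cell → Set
Separated i C D = ∀ {b} → (i , b) ∈ C → (suc i , not b) ∈ D → ⊥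

module _ {i : ℕ} where

  private
    t = transpose i

  increasing-transpose : ∀ r c xs → Separated i (rowCells r c xs) (rowCells r c xs) →
    T (increasing xs) → T (increasing (map t xs))
  increasing-transpose r c []           _   _   = _
  increasing-transpose r c (x ∷ [])     _   _   = _
  increasing-transpose r c (x ∷ y ∷ xs) sep inc =
    T-∧⁺ (<⇒<ᵇ (transpose-< i (<ᵇ⇒< x y (proj₁ (T-∧⁻ inc))) not-pair))
         (increasing-transpose r (suc c) (y ∷ xs) (λ ib∈ jb∈ → sep (there ib∈) (there jb∈))
                               (proj₂ (T-∧⁻ {a = x <ᵇ y} inc)))
    where
    not-pair : ¬ (x ≡ i × y ≡ suc i)
    not-pair (refl , refl) = sep (here refl) (there (here (cong (suc i ,_) (sym (cong odd (+-suc r c))))))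

  rows-transpose : ∀ r F → Separated i (cellsFrom r F) (cellsFrom r F) →
    T (allᵇ increasing F) → T (allᵇ increasing (τ i F))
  rows-transpose r []           _   _   = _
  rows-transpose r (row ∷ rows) sep inc =
    T-∧⁺ (increasing-transpose r 0 row (λ ib∈ jb∈ → sep (∈-++⁺ˡ ib∈) (∈-++⁺ˡ jb∈)) (proj₁ (T-∧⁻ inc)))
         (rows-transpose (suc r) rows (λ ib∈ jb∈ → sep (∈-++⁺ʳ top ib∈) (∈-++⁺ʳ top jb∈))
                         (proj₂ (T-∧⁻ {a = increasing row} inc)))
    where top = rowCells r 0 row

  columnOK-transpose : ∀ r c xs ys → Separated i (rowCells r c xs) (rowCells (suc r) c ys) →
    T (columnOK xs ys) → T (columnOK (map t xs) (map t ys))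
  columnOK-transpose r c xs       []       _   _  = _
  columnOK-transpose r c (x ∷ xs) (y ∷ ys) sep ok =
    T-∧⁺ (<⇒<ᵇ (transpose-< i (<ᵇ⇒< x y (proj₁ (T-∧⁻ ok))) not-pair))
         (columnOK-transpose r (suc c) xs ys (λ ib∈ jb∈ → sep (there ib∈) (there jb∈))
                             (proj₂ (T-∧⁻ {a = x <ᵇ y} ok)))
    where
    not-pair : ¬ (x ≡ i × y ≡ suc i)
    not-pair (refl , refl) = sep (here refl) (here refl)

  columns-transpose : ∀ r F → Separated i (cellsFrom r F) (cellsFrom r F) →
    T (columnsIncreasing F) → T (columnsIncreasing (τ i F))
  columns-transpose r []          _   _    = _
  columns-transpose r (a ∷ [])    _   _    = _
  columns-transpose r (a ∷ b ∷ F) sep cols =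
    T-∧⁺ (columnOK-transpose r 0 a b (λ ib∈ jb∈ → sep (∈-++⁺ˡ ib∈) (∈-++⁺ʳ top (∈-++⁺ˡ jb∈)))
                             (proj₁ (T-∧⁻ cols)))
         (columns-transpose (suc r) (b ∷ F) (λ ib∈ jb∈ → sep (∈-++⁺ʳ top ib∈) (∈-++⁺ʳ top jb∈))
                            (proj₂ (T-∧⁻ {a = columnOK a b} cols)))
    where top = rowCells r 0 a

colour-transpose : ∀ i v C → colour v (map (map₁ (transpose i)) C) ≡ colour (transpose i v) C
colour-transpose i v []             = refl
colour-transpose i v ((x , b) ∷ C) rewrite ≡ᵇ-transpose i v x | colour-transpose i v C = refl

shapeOf-τ : ∀ i F → shapeOf (τ i F) ≡ shapeOf F
shapeOf-τ i []      = refl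
shapeOf-τ i (r ∷ F) = cong₂ _∷_ (length-map (transpose i) r) (shapeOf-τ i F)

readingWord-τ : ∀ i F → readingWord (τ i F) ≡ map (transpose i) (readingWord F)
readingWord-τ i = concat-map

module _ {λ' F} (syt : IsSYT λ' F) {i} (1≤i : 1 ≤ i) (1+i≤N : suc i ≤ size λ')
         (mono : colour i (cells F) ≡ colour (suc i) (cells F)) where
  open IsSYT syt

  private
    t = transpose i
    N = size λ'

  separated : Separated i (cells F) (cells F)
  separated ib∈ jb∈ =
    not-¬ refl (trans (sym (colour-cell syt ib∈)) (trans mono (colour-cell syt jb∈)))

  inRange-transpose : ∀ x → T ((1 ≤ᵇ x) ∧ (x ≤ᵇ N)) → T ((1 ≤ᵇ t x) ∧ (t x ≤ᵇ N))
  inRange-transpose x x∈ with position i x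
  ... | at-i     rewrite transpose-i i     = T-∧⁺ (≤⇒≤ᵇ (s≤s (z≤n {i}))) (≤⇒≤ᵇ 1+i≤N)
  ... | at-suc-i rewrite transpose-suc-i i = T-∧⁺ (≤⇒≤ᵇ 1≤i) (≤⇒≤ᵇ (<⇒≤ 1+i≤N))
  ... | elsewhere x≢i x≢1+i rewrite transpose-elsewhere x≢i x≢1+i = x∈

  IsSYT-τ : IsSYT λ' (τ i F)
  IsSYT-τ = record
    { hasShape        = subst (λ s → T (eqShape s λ')) (sym (shapeOf-τ i F)) hasShape
    ; inRange         = subst (T ∘ allᵇ _) (sym (readingWord-τ i F))
                              (allᵇ-intro (map t (readingWord F)) in-range)
    ; distinctEntries = subst T (sym (trans (cong distinct (readingWord-τ i F))
                                            (distinct-transpose i (readingWord F))))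
                              distinctEntries
    ; rowsIncrease    = rows-transpose 0 F separated rowsIncrease
    ; columnsIncrease = columns-transpose 0 F separated columnsIncrease
    }
    where
    in-range : ∀ {y} → y ∈ map t (readingWord F) → T ((1 ≤ᵇ y) ∧ (y ≤ᵇ N))
    in-range y∈ with ∈-map⁻ t y∈
    ... | x , x∈ , refl = inRange-transpose x (allᵇ-∈ (readingWord F) inRange x∈)

  colour-τ : ∀ v → colour v (cells (τ i F)) ≡ colour v (cells F)
  colour-τ v rewrite cellsFrom-map t 0 F | colour-transpose i v (cells F) with position i v
  ... | at-i     rewrite transpose-i i     = sym mono
  ... | at-suc-i rewrite transpose-suc-i i = mono
  ... | elsewhere v≢i v≢1+i rewrite transpose-elsewhere v≢i v≢1+i = refl

  sgn-τ : sgn (τ i F) ≡ - sgn F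
  sgn-τ = trans (cong sgnWord (readingWord-τ i F))
                (sgnWord-transpose i (readingWord F) distinctEntries
                   (every-entry-occurs syt 1≤i (<⇒≤ 1+i≤N)) (every-entry-occurs syt (s≤s z≤n) 1+i≤N))

-- The sign-reversing involution

firstSameColour : Shape → ℕ → Filling → Bool
firstSameColour λ' j F = isSYT λ' F ∧ isFirst (sameColour (cells F)) j

firstSameColour-τ : ∀ λ' {j} F → suc (suc j) ≤ size λ' → T (firstSameColour λ' j F) →
  T (firstSameColour λ' j (τ (suc j) F)) × sgn (τ (suc j) F) ≡ - sgn F
firstSameColour-τ λ' {j} F 2+j≤N first =
  T-∧⁺ (IsSYT⇒isSYT (IsSYT-τ syt (s≤s z≤n) 2+j≤N mono))
       (subst T (sym (isFirst-cong same-colours j)) isFirst-j) ,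
  sgn-τ syt (s≤s z≤n) 2+j≤N mono
  where
  syt : IsSYT λ' F
  syt = isSYT⇒IsSYT (proj₁ (T-∧⁻ first))
  isFirst-j : T (isFirst (sameColour (cells F)) j)
  isFirst-j = proj₂ (T-∧⁻ {a = isSYT λ' F} first)
  mono : colour (suc j) (cells F) ≡ colour (suc (suc j)) (cells F)
  mono = T-not-xor⇒≡ (proj₁ (T-∧⁻ isFirst-j))
  same-colours : ∀ k → sameColour (cells (τ (suc j) F)) k ≡ sameColour (cells F) k
  same-colours k = cong₂ (λ a b → not (a xor b)) (colour-τ syt (s≤s z≤n) 2+j≤N mono (suc k))
                                                 (colour-τ syt (s≤s z≤n) 2+j≤N mono (suc (suc k)))

nonChessTerm : Shape → ℕ → Filling → ℤ
nonChessTerm λ' j F = if firstSameColour λ' j F then sgn F else 0ℤ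

nonChessTerm-τ : ∀ λ' {j} → suc (suc j) ≤ size λ' → ∀ F →
  nonChessTerm λ' j (τ (suc j) F) ≡ - nonChessTerm λ' j F
nonChessTerm-τ λ' {j} 2+j≤N F
  with firstSameColour λ' j F in first | firstSameColour λ' j (τ (suc j) F) in first′
... | true  | true  = proj₂ (firstSameColour-τ λ' F 2+j≤N (≡true⇒T first))
... | true  | false = ⊥-elim (T⇒≢false (proj₁ (firstSameColour-τ λ' F 2+j≤N (≡true⇒T first))) first′)
... | false | true  =
  ⊥-elim (T⇒≢false (subst (T ∘ firstSameColour λ' j) (τ-involutive (suc j) F)
                          (proj₁ (firstSameColour-τ λ' (τ (suc j) F) 2+j≤N (≡true⇒T first′)))) first)
... | false | false = refl

∑-nonChessTerm≡0 : ∀ λ' {j} → j ∈ upTo (pred (size λ')) →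
  ∑ (fillings λ') (nonChessTerm λ' j) ≡ 0ℤ
∑-nonChessTerm≡0 λ' {j} j∈ =
  ∑-sign-reversing (τ (suc j)) (nonChessTerm λ' j) (fillings-τ λ' (s≤s z≤n) 2+j≤N)
                   (nonChessTerm-τ λ' 2+j≤N)
  where
  2+j≤N : suc (suc j) ≤ size λ'
  2+j≤N = <pred⇒2+≤ (∈-upTo⁻ j∈)

sytTerm-split : ∀ λ' F →
  (if isSYT λ' F then sgn F else 0ℤ) ≡
  (if isSCT λ' F then sgn F else 0ℤ) +ℤ ∑ (upTo (pred (size λ'))) (λ j → nonChessTerm λ' j F)
sytTerm-split λ' F with isSYT λ' F in syt
... | false = sym (trans (ℤP.+-identityˡ _) (∑-zero (upTo (pred (size λ'))) (λ _ → refl)))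
... | true  =
  trans (split (any p js))
        (cong₂ _+ℤ_ (cong (λ b → if b then sgn F else 0ℤ) (sym (isChess≡no-sameColour syt′)))
                    (sym (∑-isFirst p (sgn F) (pred (size λ')))))
  where
  p : ℕ → Bool
  p = sameColour (cells F)
  js : List ℕ
  js = upTo (pred (size λ'))
  split : ∀ b → sgn F ≡ (if not b then sgn F else 0ℤ) +ℤ (if b then sgn F else 0ℤ)
  split false = sym (ℤP.+-identityʳ (sgn F))
  split true  = sym (ℤP.+-identityˡ (sgn F))
  syt′ : IsSYT λ' F
  syt′ = isSYT⇒IsSYT (≡true⇒T syt)

-- The argument never uses that the row lengths decrease.
lemma4p1 : (λ' : Shape) → IsPartition λ' → chessSum λ' ≡ I λ'
lemma4p1 λ' _ = begin
  chessSum λ'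
    ≡⟨ ∑-if (isSCT λ') sgn Fs ⟨
  ∑ Fs chessTerm
    ≡⟨ ℤP.+-identityʳ _ ⟨
  ∑ Fs chessTerm +ℤ 0ℤ
    ≡⟨ cong (∑ Fs chessTerm +ℤ_) (∑-zero js (∑-nonChessTerm≡0 λ')) ⟨
  ∑ Fs chessTerm +ℤ ∑ js (λ j → ∑ Fs (nonChessTerm λ' j))
    ≡⟨ cong (∑ Fs chessTerm +ℤ_) (∑-comm Fs js (λ F j → nonChessTerm λ' j F)) ⟨
  ∑ Fs chessTerm +ℤ ∑ Fs (λ F → ∑ js (λ j → nonChessTerm λ' j F))
    ≡⟨ ∑-+ Fs chessTerm _ ⟨
  ∑ Fs (λ F → chessTerm F +ℤ ∑ js (λ j → nonChessTerm λ' j F))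
    ≡⟨ ∑-cong Fs (sytTerm-split λ') ⟨
  ∑ Fs (λ F → if isSYT λ' F then sgn F else 0ℤ)
    ≡⟨ ∑-if (isSYT λ') sgn Fs ⟩
  I λ'
    ∎
  where
  open ≡-Reasoning
  Fs : List Filling
  Fs = fillings λ'
  js : List ℕ
  js = upTo (pred (size λ'))
  chessTerm : Filling → ℤ
  chessTerm F = if isSCT λ' F then sgn F else 0ℤ
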